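{- Let $(G,\pi_0)$ be a colored graph and consider any proof for $(G,\pi_0)$ in the proof system described in the context. If the proof derives the fact $\Omega\vartriangleleft\operatorname{orbits}(G,\pi_0,\nu)$, then $\Omega$ is a subset of an orbit of $Aut(G,\pi)$, where $\pi=\bar R(G,\pi_0,\nu)$; that is, for all $u_1,u_2\in\Omega$ there is $\sigma\in Aut(G,\pi)$ with $u_1^\sigma=u_2$.
   Context: Graphs and colorings: $G=(V,E)$ is a finite undirected graph with $V=\{1,\dots,n\}$. A coloring is a surjection $\pi:V\to\{1,\dots,m\}$, identified with the ordered sequence of its cells. $\pi'\preceq\pi$ means that $\pi(u)<\pi(v)$ implies $\pi'(u)<\pi'(v)$; $\pi'\prec\pi$ means $\pi'\preceq\pi$ and $\pi'\ne\pi$. A coloring is discrete if all cells are singletons; a discrete coloring is a permutation of $V$. A permutation $\sigma$ acts by $G^\sigma=(V,\{(u^\sigma,v^\sigma):(u,v)\in E\})$, $\pi^\sigma(v^\sigma)=\pi(v)$ (cells mapped, order preserved), and elementwise on vertex sets and sequences. $Aut(G,\pi)=\{\sigma:G^\sigma=G,\pi^\sigma=\pi\}$. For a discrete $\pi$, $G^\pi,\pi_0^\pi$ are the images under the permutation $\pi$. For $\nu=[v_1,\dots,v_k]$: $[\nu,w]=[v_1,\dots,v_k,w]$; $<_{lex}$ is the lexicographic order. Refinement: the procedure make\_equitable$(G,\pi,\alpha)$, with $\alpha$ a list of cells of $\pi$, works as follows. Set $\pi':=\pi$. While $\pi'$ is not discrete and $\alpha\ne\emptyset$: 1. Let $W$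 be the first cell of $\pi'$ lying in $\alpha$. Remove it from $\alpha$. 2. For each non-singleton cell $X$ of $\pi'$: - partition $X$ into the classes $X_1,\dots,X_k$ of vertices with equal numbers of neighbours in $W$, ordered by increasing number; - let $j$ be the smallest index with $|X_j|$ maximal; - replace $X$ in place by $X_1,\dots,X_{j-1},X_{j+1},\dots,X_k,X_j$; - add each $X_i$ ($i\neq j$) to $\alpha$, and if $X\in\alpha$, replace it by $X_j$. Return $\pi'$. The refinement function $\bar R$ is defined recursively: - $\bar R(G,\pi_0,[\,])=$make\_equitable$(G,\pi_0,\text{all cells of }\pi_0)$; - $\bar R(G,\pi_0,[\nu',v])=$make\_equitable$(G,\pi'',[\{v\}])$, where $\pi''$ is $\bar R(G,\pi_0,\nu')$ with the cell $W\ni v$ replaced in place by $\{v\},W\setminus\{v\}$. $\bar T(G,\pi_0,\nu)$ is the first non-singleton cell of $\bar R(G,\pi_0,\nu)$, or $\emptyset$. Fix a function hash from colored graphs to a totally ordered set with hash$(G^\sigma,\pi^\sigma)=$hash$(G,\pi)$. Then $\bar\phi(G,\pi_0,[v_1,\dots,v_k])=[h_1,\dots,h_k]$ with $h_i=$hash$(G,\bar R(G,\pi_0,[v_1,\dots,v_i]))$. Fix a total order on graphs with vertex set $V$. Proof system for fixed $(G,\pi_0)$. Facts are the formal expressions: - $\bar R(G,\pi_0,\nu)=\pi$; - $\bar R(G,\pi_0,\nu)\preceq\pi$; - $\bar T(G,\pi_0,\nu)=W$; - $\Omega\vartriangleleft\operatorname{orbits}(G,\pi_0,\nu)$; - $\bar\phi(G,\pi_0,\nu')=\bar\phi(G,\pi_0,\nu'')$;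 - $\operatorname{pruned}(G,\pi_0,\nu)$; - $\operatorname{on\_path}(G,\pi_0,\nu)$; - $C(G,\pi_0)=(G',\pi')$. Auxiliary functions: - $\operatorname{ind}(\pi,v)$ replaces the cell $W\ni v$ in place by $\{v\},W\setminus\{v\}$; - $\operatorname{split}(G,\pi,i)$ replaces each cell by the fragments of vertices with equal numbers of neighbours in the $i$-th cell of $\pi$, sorted ascending, with the first maximum-size fragment moved to the end; - $\operatorname{cell}_j(\pi)$ is the $j$-th cell. A proof is a finite sequence of rule applications whose premises are derived earlier and whose side conditions hold. The rules ($G,\pi_0$ omitted): - ColoringAxiom: $\Rightarrow\bar R([\,])\preceq\pi_0$. - Individualize: $\bar R(\nu)=\pi\Rightarrow\bar R([\nu,v])\preceq\operatorname{ind}(\pi,v)$. - SplitColoring: $\bar R(\nu)\preceq\pi\Rightarrow\bar R(\nu)\preceq\operatorname{split}(G,\pi,i)$ with $i=\min\{j:\operatorname{split}(G,\pi,j)\prec\pi\}$ [it exists]. - Equitable: $\bar R(\nu)\preceq\pi\Rightarrow\bar R(\nu)=\pi$ [$\operatorname{split}(G,\pi,i)=\pi$ for all $i$]. - TargetCell: $\bar R(\nu)=\pi\Rightarrow\bar T(\nu)=\operatorname{cell}_i(\pi)$ with $i=\min\{j:|\operatorname{cell}_j(\pi)|>1\}$ [it exists]. - InvariantAxiom: $\Rightarrow\bar\phi(\nu)=\bar\phi(\nu)$. - InvariantsEqual: $\bar\phi(\nu')=\bar\phi(\nu'')$, $\bar R([\nu',v'])=\pi_1$, $\bar R([\nu'',v''])=\pi_2\Rightarrow\bar\phi([\nu',v'])=\bar\phi([\nu'',v''])$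 [hash$(G,\pi_1)=$hash$(G,\pi_2)$]. - InvariantsEqualSym: symmetry of the previous fact. - OrbitsAxiom: $\Rightarrow\{v\}\vartriangleleft\operatorname{orbits}(\nu)$ for any vertex $v$ and sequence $\nu$. - MergeOrbits: $\Omega_1\vartriangleleft\operatorname{orbits}(\nu)$, $\Omega_2\vartriangleleft\operatorname{orbits}(\nu)\Rightarrow\Omega_1\cup\Omega_2\vartriangleleft\operatorname{orbits}(\nu)$ [there are $\sigma\in Aut(G,\pi_0)$ with $\nu^\sigma=\nu$ and $w_1\in\Omega_1$, $w_2\in\Omega_2$ with $w_1^\sigma=w_2$]. - PruneInvariant: $\bar\phi(\nu')=\bar\phi(\nu'')$, $\bar R([\nu',v'])=\pi_1$, $\bar R([\nu'',v''])=\pi_2\Rightarrow\operatorname{pruned}([\nu'',v''])$ [hash$(G,\pi_1)>$hash$(G,\pi_2)$]. - PruneLeaf: $\bar R(\nu')=\pi_1$, $\bar R(\nu'')=\pi_2$, $\bar\phi(\nu')=\bar\phi(\nu'')\Rightarrow\operatorname{pruned}(\nu'')$ [$\pi_2$ discrete, and ($\pi_1$ not discrete or $G^{\pi_1}>G^{\pi_2}$)]. - PruneAutomorphism: $\Rightarrow\operatorname{pruned}(\nu'')$ [there are $\nu'<_{lex}\nu''$ and $\sigma\in Aut(G,\pi_0)$ with $\nu'^\sigma=\nu''$]. - PruneOrbits: $\Omega\vartriangleleft\operatorname{orbits}(\nu)\Rightarrow\operatorname{pruned}([\nu,w_2])$ [$w_2\in\Omega$ and some $w_1\in\Omega$ has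 $w_1<w_2$]. - PruneParent: $\bar T(\nu)=W$ and $\operatorname{pruned}([\nu,w])$ for all $w\in W\Rightarrow\operatorname{pruned}(\nu)$. - PathAxiom: $\Rightarrow\operatorname{on\_path}([\,])$. - ExtendPath: $\operatorname{on\_path}(\nu)$, $\bar T(\nu)=W$, $\operatorname{pruned}([\nu,w'])$ for all $w'\in W\setminus\{w\}\Rightarrow\operatorname{on\_path}([\nu,w])$. - CanonicalLeaf: $\operatorname{on\_path}(\nu)$, $\bar R(\nu)=\pi\Rightarrow C(G,\pi_0)=(G^\pi,\pi_0^\pi)$ [$\pi$ discrete]. -}

module Defs where

open import Data.Nat as ℕ using (ℕ; zero; suc; _+_; _<_; _≡ᵇ_; _⊔_)
open import Data.Fin as Fin using (Fin; toℕ)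
open import Data.Fin.Permutation using (Permutation′; _⟨$⟩ʳ_; _⟨$⟩ˡ_)
open import Data.Bool using (Bool; true; false; if_then_else_; not)
open import Data.List as List using (List; []; _∷_; _++_; _∷ʳ_; length; map; foldl; foldr; concat; concatMap; allFin; upTo; filterᵇ)
open import Data.Bool.ListAction using (any; all)
open import Data.List.Properties using (≡-dec)
open import Data.List.Membership.Propositional using (_∈_)
open import Data.List.Relation.Unary.All using (All)
open import Data.List.Relation.Binary.Permutation.Propositional using (_↭_)
open import Data.List.Relation.Binary.Lex.Core using (Lex-<)
open import Data.Maybe using (Maybe; just; nothing)
open import Data.Product using (Σ; ∃; _×_; _,_)
open import Data.Sum using (_⊎_)
open import Relation.Nullary using (¬_)
open import Relation.Nullary.Decidable using (⌊_⌋)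
open import Relation.Binary.PropositionalEquality using (_≡_; _≢_)
open import Relation.Binary.Structures using (IsStrictTotalOrder)

-- Graphs on V = Fin n (vertex i of the paper is Fin index i-1)

Adj : ℕ → Set
Adj n = Fin n → Fin n → Bool

record Graph (n : ℕ) : Set where
  field
    adj : Adj n
    adj-sym : ∀ u v → adj u v ≡ adj v u

Cell : ℕ → Set
Cell n = List (Fin n)

Coloring : ℕ → Set
Coloring n = List (Cell n)

IsColoring : ∀ {n} → Coloring n → Set
IsColoring {n} π = All (λ c → c ≢ []) π × (concat π ↭ allFin n)

_=ᵛ_ : ∀ {n} → Fin n → Fin n → Bool
u =ᵛ v = ⌊ u Fin.≟ v ⌋

_=ᶜ_ : ∀ {n} → Cell n → Cell n → Bool
X =ᶜ Y = ⌊ ≡-dec Fin._≟_ X Y ⌋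

memᵛ : ∀ {n} → Fin n → Cell n → Bool
memᵛ v X = any (v =ᵛ_) X

memᶜ : ∀ {n} → Cell n → List (Cell n) → Bool
memᶜ X α = any (X =ᶜ_) α

-- the color π(v), i.e. the (0-based) index of the cell containing v
col : ∀ {n} → Coloring n → Fin n → ℕ
col [] v = 0
col (X ∷ π) v = if memᵛ v X then 0 else suc (col π v)

_⪯_ : ∀ {n} → Coloring n → Coloring n → Set
π' ⪯ π = ∀ u v → col π u < col π v → col π' u < col π' v

_≈c_ : ∀ {n} → Coloring n → Coloring n → Set
π' ≈c π = ∀ v → col π' v ≡ col π v

_≺_ : ∀ {n} → Coloring n → Coloring n → Set
π' ≺ π = (π' ⪯ π) × ¬ (π' ≈c π)

discrete : ∀ {n} → Coloring n → Bool
discrete π = all (λ X → length X ≡ᵇ 1) π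

cellAt : ∀ {n} → Coloring n → ℕ → Cell n
cellAt [] i = []
cellAt (X ∷ π) zero = X
cellAt (X ∷ π) (suc i) = cellAt π i

firstNonSingleton : ∀ {n} → Coloring n → Maybe (Cell n)
firstNonSingleton [] = nothing
firstNonSingleton (X ∷ π) = if length X ≡ᵇ 1 then firstNonSingleton π else just X

nonEmptyCell : ∀ {n} → Cell n → Coloring n
nonEmptyCell [] = []
nonEmptyCell (x ∷ X) = (x ∷ X) ∷ []

ind : ∀ {n} → Coloring n → Fin n → Coloring n
ind [] v = []
ind (X ∷ π) v =
  if memᵛ v X
  then ((v ∷ []) ∷ nonEmptyCell (filterᵇ (λ u → not (u =ᵛ v)) X)) ++ π
  else X ∷ ind π v

deg : ∀ {n} → Adj n → Cell n → Fin n → ℕ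
deg a W v = length (filterᵇ (a v) W)

dropEmpty : ∀ {n} → List (Cell n) → List (Cell n)
dropEmpty [] = []
dropEmpty ([] ∷ xs) = dropEmpty xs
dropEmpty ((x ∷ X) ∷ xs) = (x ∷ X) ∷ dropEmpty xs

fragments : ∀ {n} → Adj n → Cell n → Cell n → List (Cell n)
fragments a W X =
  dropEmpty (map (λ k → filterBy k) (upTo (suc (length W))))
  where filterBy : ℕ → Cell _
        filterBy k = filterᵇ (λ v → deg a W v ≡ᵇ k) X

maxLen : ∀ {n} → List (Cell n) → ℕ
maxLen = foldr (λ X m → length X ⊔ m) 0

pick : ∀ {n} → ℕ → List (Cell n) → List (Cell n) × Maybe (Cell n)
pick m [] = [] , nothing
pick m (X ∷ xs) with length X ≡ᵇ m | pick m xs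
... | true  | _ = xs , just X
... | false | (o , c) = (X ∷ o) , c

splitCell : ∀ {n} → Adj n → Cell n → Cell n → List (Cell n) × Cell n
splitCell a W X with pick (maxLen (fragments a W X)) (fragments a W X)
... | (o , just c) = o , c
... | (o , nothing) = o , X

-- split(G,π,i) (cells indexed from 0)
split : ∀ {n} → Adj n → Coloring n → ℕ → Coloring n
split a π i = concatMap (λ X → ordered (splitCell a (cellAt π i) X)) π
  where ordered : List (Cell _) × Cell _ → List (Cell _)
        ordered (o , c) = o ∷ʳ c

stepCells : ∀ {n} → Adj n → Cell n → Coloring n → List (Cell n) → Coloring n × List (Cell n)
stepCells a W [] α = [] , α
stepCells a W (X ∷ π) α with splitCell a W X
... | (o , c) with stepCells a W π (map (λ Y → if Y =ᶜ X then c else Y) α ++ o)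
... | (π' , α') = ((o ∷ʳ c) ++ π') , α'

firstIn : ∀ {n} → Coloring n → List (Cell n) → Maybe (Cell n)
firstIn [] α = nothing
firstIn (X ∷ π) α = if memᶜ X α then just X else firstIn π α

removeCell : ∀ {n} → Cell n → List (Cell n) → List (Cell n)
removeCell W α = filterᵇ (λ Y → not (Y =ᶜ W)) α

equitLoop : ∀ {n} → ℕ → Adj n → Coloring n → List (Cell n) → Coloring n
equitLoop zero a π α = π
equitLoop (suc f) a π α with discrete π | firstIn π α
... | true  | _ = π
... | false | nothing = π
... | false | just W with stepCells a W π (removeCell W α)
... | (π' , α') = equitLoop f a π' α'

-- the loop performs at most |α| + n iterations (every iteration removes one
-- element of α, and every addition to α creates a new cell), so this fuel
-- never runs out
makeEquitable : ∀ {n} → Adj n → Coloring n → List (Cell n) → Coloring n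
makeEquitable {n} a π α = equitLoop (suc (length α + n)) a π α

Rbar : ∀ {n} → Graph n → Coloring n → List (Fin n) → Coloring n
Rbar G π₀ ν =
  foldl (λ π v → makeEquitable (Graph.adj G) (ind π v) ((v ∷ []) ∷ []))
        (makeEquitable (Graph.adj G) π₀ π₀) ν

IsAut : ∀ {n} → Adj n → Coloring n → Permutation′ n → Set
IsAut a π σ = (∀ u v → a (σ ⟨$⟩ʳ u) (σ ⟨$⟩ʳ v) ≡ a u v)
            × (∀ v → col π (σ ⟨$⟩ʳ v) ≡ col π v)

findᵇ : ∀ {A : Set} → (A → Bool) → List A → Maybe A
findᵇ p [] = nothing
findᵇ p (x ∷ xs) = if p x then just x else findᵇ p xs

-- for a discrete π (a permutation v ↦ col π v), the vertex at position i
vertexAt : ∀ {n} → Coloring n → Fin n → Fin n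
vertexAt {n} π i with findᵇ (λ v → col π v ≡ᵇ toℕ i) (allFin n)
... | just v = v
... | nothing = i

relabel : ∀ {n} → Adj n → Coloring n → Adj n
relabel a π x y = a (vertexAt π x) (vertexAt π y)

relabelCol : ∀ {n} → Coloring n → Coloring n → Fin n → ℕ
relabelCol π₀ π x = col π₀ (vertexAt π x)

record Setting (n : ℕ) : Set₁ where
  field
    H : Set
    _<H_ : H → H → Set
    <H-isSTO : IsStrictTotalOrder _≡_ _<H_
    hash : Adj n → (Fin n → ℕ) → H
    hash-cong : ∀ a a' c c' → (∀ u v → a u v ≡ a' u v) → (∀ v → c v ≡ c' v) → hash a c ≡ hash a' c'
    hash-inv : ∀ (σ : Permutation′ n) a c →
      hash (λ x y → a (σ ⟨$⟩ˡ x) (σ ⟨$⟩ˡ y)) (λ x → c (σ ⟨$⟩ˡ x)) ≡ hash a c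
    _<G_ : Adj n → Adj n → Set
    <G-isSTO : IsStrictTotalOrder (λ a b → ∀ u v → a u v ≡ b u v) _<G_

data Fact (n : ℕ) : Set where
  R≡ : List (Fin n) → Coloring n → Fact n          -- R̄(ν) = π
  R⪯ : List (Fin n) → Coloring n → Fact n          -- R̄(ν) ⪯ π
  T≡ : List (Fin n) → Cell n → Fact n              -- T̄(ν) = W
  orbits : List (Fin n) → List (Fin n) → Fact n    -- orbits Ω ν : Ω ◁ orbits(ν)
  φ≡ : List (Fin n) → List (Fin n) → Fact n        -- φ̄(ν') = φ̄(ν'')
  pruned : List (Fin n) → Fact n
  onPath : List (Fin n) → Fact n
  canon : Adj n → (Fin n → ℕ) → Fact n             -- C(G,π₀) = (G',π')

module ProofSystem {n : ℕ} (G : Graph n) (π₀ : Coloring n) (S : Setting n) where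
  open Graph G
  open Setting S

  hashC : Coloring n → H
  hashC π = hash adj (col π)

  data ⊢_ : Fact n → Set where
    coloringAxiom : ⊢ R⪯ [] π₀
    individualize : ∀ {ν π} v → ⊢ R≡ ν π → ⊢ R⪯ (ν ∷ʳ v) (ind π v)
    splitColoring : ∀ {ν π} i → i < length π → split adj π i ≺ π →
      (∀ j → j < i → ¬ (split adj π j ≺ π)) →
      ⊢ R⪯ ν π → ⊢ R⪯ ν (split adj π i)
    equitable : ∀ {ν π} → (∀ i → i < length π → split adj π i ≈c π) →
      ⊢ R⪯ ν π → ⊢ R≡ ν π
    targetCell : ∀ {ν π W} → firstNonSingleton π ≡ just W → ⊢ R≡ ν π → ⊢ T≡ ν W
    invariantAxiom : ∀ ν → ⊢ φ≡ ν ν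
    invariantsEqual : ∀ {ν' ν'' v' v'' π₁ π₂} → hashC π₁ ≡ hashC π₂ →
      ⊢ φ≡ ν' ν'' → ⊢ R≡ (ν' ∷ʳ v') π₁ → ⊢ R≡ (ν'' ∷ʳ v'') π₂ →
      ⊢ φ≡ (ν' ∷ʳ v') (ν'' ∷ʳ v'')
    invariantsEqualSym : ∀ {ν' ν''} → ⊢ φ≡ ν' ν'' → ⊢ φ≡ ν'' ν'
    orbitsAxiom : ∀ v ν → ⊢ orbits (v ∷ []) ν
    mergeOrbits : ∀ {Ω₁ Ω₂ ν} (σ : Permutation′ n) w₁ w₂ →
      IsAut adj π₀ σ → map (σ ⟨$⟩ʳ_) ν ≡ ν → w₁ ∈ Ω₁ → w₂ ∈ Ω₂ → σ ⟨$⟩ʳ w₁ ≡ w₂ →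
      ⊢ orbits Ω₁ ν → ⊢ orbits Ω₂ ν → ⊢ orbits (Ω₁ ++ Ω₂) ν
    pruneInvariant : ∀ {ν' ν'' v' v'' π₁ π₂} → hashC π₂ <H hashC π₁ →
      ⊢ φ≡ ν' ν'' → ⊢ R≡ (ν' ∷ʳ v') π₁ → ⊢ R≡ (ν'' ∷ʳ v'') π₂ →
      ⊢ pruned (ν'' ∷ʳ v'')
    pruneLeaf : ∀ {ν' ν'' π₁ π₂} → discrete π₂ ≡ true →
      (discrete π₁ ≡ false ⊎ relabel adj π₂ <G relabel adj π₁) →
      ⊢ R≡ ν' π₁ → ⊢ R≡ ν'' π₂ → ⊢ φ≡ ν' ν'' → ⊢ pruned ν''
    pruneAutomorphism : ∀ ν' ν'' (σ : Permutation′ n) →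
      Lex-< _≡_ Fin._<_ ν' ν'' → IsAut adj π₀ σ → map (σ ⟨$⟩ʳ_) ν' ≡ ν'' →
      ⊢ pruned ν''
    pruneOrbits : ∀ {Ω ν} w₁ w₂ → w₂ ∈ Ω → w₁ ∈ Ω → w₁ Fin.< w₂ →
      ⊢ orbits Ω ν → ⊢ pruned (ν ∷ʳ w₂)
    pruneParent : ∀ {ν W} → ⊢ T≡ ν W → (∀ w → w ∈ W → ⊢ pruned (ν ∷ʳ w)) → ⊢ pruned ν
    pathAxiom : ⊢ onPath []
    extendPath : ∀ {ν W} w → ⊢ onPath ν → ⊢ T≡ ν W →
      (∀ w' → w' ∈ W → w' ≢ w → ⊢ pruned (ν ∷ʳ w')) → ⊢ onPath (ν ∷ʳ w)
    canonicalLeaf : ∀ {ν π} → discrete π ≡ true → ⊢ onPath ν → ⊢ R≡ ν π →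
      ⊢ canon (relabel adj π) (relabelCol π₀ π)

-- OrbitsAxiom gives singletons, and lying in one orbit of
-- Aut(G, π) is an equivalence relation, so MergeOrbits is handled
-- by transitivity once the bridging automorphism σ ∈ Aut(G, π₀) is known to lie in
-- Aut(G, R̄(ν)). That is the equivariance of refinement: if σ fixes ν pointwise then σ maps
-- every cell of R̄(ν) onto itself, because every cell is built from cells of π₀ (which σ
-- maps onto themselves) by splitting by neighbour counts and by individualizing vertices of
-- ν, and both operations commute with σ.
module Submission where

open import Defs
open import Data.Bool using (Bool; true; false; not; if_then_else_)
open import Data.Bool.Properties using (T-≡; T?)
open import Data.Empty using (⊥-elim)
open import Data.Fin as Fin using (Fin)
open import Data.Fin.Permutation
  using (Permutation′; _⟨$⟩ʳ_; _⟨$⟩ˡ_; inverseˡ; inverseʳ; id; flip; _∘ₚ_)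
open import Data.List using (List; []; _∷_; _++_; map; filterᵇ; length; foldl; upTo; concat)
open import Data.List.Properties using (length-map; ∷-injective)
open import Data.List.Membership.Propositional using (_∈_; _∉_)
open import Data.List.Membership.Propositional.Properties
  using (∈-map⁺; ∈-map⁻; ∈-++⁺ˡ; ∈-++⁺ʳ; ∈-++⁻)
open import Data.List.Membership.Propositional.Properties.WithK using (unique∧set⇒bag)
open import Data.List.Relation.Binary.BagAndSetEquality using (∼bag⇒↭)
open import Data.List.Relation.Binary.Disjoint.Propositional using (Disjoint)
open import Data.List.Relation.Binary.Permutation.Propositional
  using (_↭_; ↭-sym; ↭-trans; ↭-reflexive; ↭⇒↭ₛ)
open import Data.List.Relation.Binary.Permutation.Propositional.Properties
  using (filter-↭; ↭-length; ∈-resp-↭)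
import Data.List.Relation.Binary.Permutation.Setoid.Properties as ↭ₛ
open import Data.List.Relation.Unary.All as All using (All; []; _∷_)
import Data.List.Relation.Unary.All.Properties as All
open import Data.List.Relation.Unary.Any as Any using (here; there)
open import Data.List.Relation.Unary.Any.Properties using (any⁺; any⁻)
open import Data.List.Relation.Unary.Unique.Propositional using (Unique; []; _∷_)
import Data.List.Relation.Unary.Unique.Propositional.Properties as Unique
open import Data.Maybe using (just; nothing)
open import Data.Maybe.Relation.Unary.All as Maybe using (just; nothing)
open import Data.Nat using (ℕ; zero; suc; _≡ᵇ_)
open import Data.Nat.Properties using (suc-injective)
open import Data.Product using (∃; _×_; _,_; proj₁; proj₂)
open import Data.Sum using (inj₁; inj₂)
open import Function.Bundles using (mk⇔; Equivalence)
open import Relation.Nullary using (yes; no)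
open import Relation.Nullary.Decidable using (toWitness; fromWitness)
open import Relation.Binary.PropositionalEquality
  using (_≡_; refl; sym; trans; cong; cong₂; subst; setoid; module ≡-Reasoning)

filterᵇ-map : ∀ {A B : Set} {p : B → Bool} {q : A → Bool} (f : A → B) →
  (∀ x → p (f x) ≡ q x) → ∀ xs → filterᵇ p (map f xs) ≡ map f (filterᵇ q xs)
filterᵇ-map f p∘f≗q [] = refl
filterᵇ-map {p = p} {q} f p∘f≗q (x ∷ xs) with p (f x) | q x | p∘f≗q x
... | true  | .true  | refl = cong (f x ∷_) (filterᵇ-map f p∘f≗q xs)
... | false | .false | refl = filterᵇ-map f p∘f≗q xs

filterᵇ-↭ : ∀ {A : Set} (p : A → Bool) {xs ys} → xs ↭ ys → filterᵇ p xs ↭ filterᵇ p ys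
filterᵇ-↭ p = filter-↭ (λ x → T? (p x))

unique-++⁻ : ∀ {A : Set} (xs : List A) {ys} → Unique (xs ++ ys) →
  Unique xs × Unique ys × Disjoint xs ys
unique-++⁻ [] u = [] , u , λ ()
unique-++⁻ (x ∷ xs) (x∉ ∷ u) with unique-++⁻ xs u
... | uxs , uys , disj = (All.++⁻ˡ xs x∉ ∷ uxs) , uys , x∷xs#ys
  where
    x∷xs#ys : Disjoint (x ∷ xs) _
    x∷xs#ys (here refl , y∈) = All.lookup x∉ (∈-++⁺ʳ xs y∈) refl
    x∷xs#ys (there y∈ , y∈′) = disj (y∈ , y∈′)

bool-ext : ∀ {b c : Bool} → (b ≡ true → c ≡ true) → (c ≡ true → b ≡ true) → b ≡ c
bool-ext {true}  {true}  _ _ = refl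
bool-ext {true}  {false} f _ = sym (f refl)
bool-ext {false} {true}  _ g = g refl
bool-ext {false} {false} _ _ = refl

module _ {n : ℕ} {v : Fin n} where

  memᵛ⇒∈ : ∀ {X} → memᵛ v X ≡ true → v ∈ X
  memᵛ⇒∈ {X} eq = Any.map toWitness (any⁻ _ X (Equivalence.from T-≡ eq))

  ∈⇒memᵛ : ∀ {X} → v ∈ X → memᵛ v X ≡ true
  ∈⇒memᵛ v∈X = Equivalence.to T-≡ (any⁺ _ (Any.map fromWitness v∈X))

col-∉ : ∀ {n} (π : Coloring n) {v} → v ∉ concat π → col π v ≡ length π
col-∉ [] v∉ = refl
col-∉ (X ∷ π) {v} v∉ with memᵛ v X in m
... | true  = ⊥-elim (v∉ (∈-++⁺ˡ (memᵛ⇒∈ {X = X} m)))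
... | false = cong suc (col-∉ π (λ v∈ → v∉ (∈-++⁺ʳ X v∈)))

dropEmpty-All : ∀ {n} {P : Cell n → Set} {xs} → All P xs → All P (dropEmpty xs)
dropEmpty-All {xs = []} [] = []
dropEmpty-All {xs = [] ∷ _} (_ ∷ ps) = dropEmpty-All ps
dropEmpty-All {xs = (_ ∷ _) ∷ _} (p ∷ ps) = p ∷ dropEmpty-All ps

pick-All : ∀ {n} {P : Cell n → Set} m {xs} → All P xs →
  All P (proj₁ (pick m xs)) × Maybe.All P (proj₂ (pick m xs))
pick-All m {[]} [] = [] , nothing
pick-All m {X ∷ xs} (pX ∷ pxs) with length X ≡ᵇ m | pick m xs | pick-All m pxs
... | true  | _     | _         = pxs , just pX
... | false | o , c | po , pc   = (pX ∷ po) , pc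

splitCell-All : ∀ {n} {P : Cell n → Set} a W X → P X → All P (fragments a W X) →
  All P (proj₁ (splitCell a W X)) × P (proj₂ (splitCell a W X))
splitCell-All a W X pX pfs
  with pick (maxLen (fragments a W X)) (fragments a W X) | pick-All (maxLen (fragments a W X)) pfs
... | o , just c  | po , just pc = po , pc
... | o , nothing | po , nothing = po , pX

firstIn-All : ∀ {n} {P : Cell n → Set} {π} α → All P π → Maybe.All P (firstIn π α)
firstIn-All α [] = nothing
firstIn-All {π = X ∷ _} α (pX ∷ pπ) with memᶜ X α
... | true  = just pX
... | false = firstIn-All α pπ

IndClosed : ∀ {n} → (Cell n → Set) → Fin n → Set
IndClosed P v = P (v ∷ []) × (∀ {X} → P X → P (filterᵇ (λ u → not (u =ᵛ v)) X))

module Refinement {n : ℕ} (G : Graph n) (P : Cell n → Set)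
  (fragments-closed : ∀ {W X} → P W → P X → All P (fragments (Graph.adj G) W X)) where

  private
    a : Adj n
    a = Graph.adj G

  stepCells-All : ∀ {W} → P W → ∀ π α → All P π → All P (proj₁ (stepCells a W π α))
  stepCells-All pW [] α [] = []
  stepCells-All {W} pW (X ∷ π) α (pX ∷ pπ)
    with splitCell a W X | splitCell-All a W X pX (fragments-closed pW pX)
  ... | o , c | po , pc
    with stepCells a W π (map (λ Y → if Y =ᶜ X then c else Y) α ++ o)
       | stepCells-All pW π (map (λ Y → if Y =ᶜ X then c else Y) α ++ o) pπ
  ... | π′ , α′ | pπ′ = All.++⁺ (All.++⁺ po (pc ∷ [])) pπ′

  equitLoop-All : ∀ f π α → All P π → All P (equitLoop f a π α)
  equitLoop-All zero π α pπ = pπ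
  equitLoop-All (suc f) π α pπ with discrete π | firstIn π α | firstIn-All α pπ
  ... | true  | _       | _       = pπ
  ... | false | nothing | _       = pπ
  ... | false | just W  | just pW
    with stepCells a W π (removeCell W α) | stepCells-All pW π (removeCell W α) pπ
  ... | π′ , α′ | pπ′ = equitLoop-All f π′ α′ pπ′

  makeEquitable-All : ∀ π α → All P π → All P (makeEquitable a π α)
  makeEquitable-All π α = equitLoop-All _ π α

  ind-All : ∀ {v} → IndClosed P v → ∀ π → All P π → All P (ind π v)
  ind-All _ [] [] = []
  ind-All {v} (p[v] , filter-closed) (X ∷ π) (pX ∷ pπ) with memᵛ v X
  ... | true  = p[v] ∷ All.++⁺ (nonEmptyCell-All (filter-closed pX)) pπ
    where
      nonEmptyCell-All : ∀ {Y} → P Y → All P (nonEmptyCell Y)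
      nonEmptyCell-All {[]} _ = []
      nonEmptyCell-All {_ ∷ _} pY = pY ∷ []
  ... | false = pX ∷ ind-All (p[v] , filter-closed) π pπ

  individualize-All : ∀ ν π → All (IndClosed P) ν → All P π →
    All P (foldl (λ π v → makeEquitable a (ind π v) ((v ∷ []) ∷ [])) π ν)
  individualize-All [] π [] pπ = pπ
  individualize-All (v ∷ ν) π (cv ∷ cν) pπ =
    individualize-All ν _ cν (makeEquitable-All _ _ (ind-All cv π pπ))

  Rbar-All : ∀ {π₀ ν} → All (IndClosed P) ν → All P π₀ → All P (Rbar G π₀ ν)
  Rbar-All {π₀} {ν} cν pπ₀ = individualize-All ν _ cν (makeEquitable-All π₀ π₀ pπ₀)

module _ {n : ℕ} (σ : Permutation′ n) where

  -- Up to multiplicity, not just as a set: deg counts neighbours with multiplicity.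
  Stable : Cell n → Set
  Stable X = map (σ ⟨$⟩ʳ_) X ↭ X

  private
    s : Fin n → Fin n
    s = σ ⟨$⟩ʳ_

    s-injective : ∀ {x y} → s x ≡ s y → x ≡ y
    s-injective eq = trans (sym (inverseˡ σ)) (trans (cong (σ ⟨$⟩ˡ_) eq) (inverseˡ σ))

  filterᵇ-stable : ∀ (p : Fin n → Bool) → (∀ x → p (s x) ≡ p x) → ∀ {X} → Stable X →
    Stable (filterᵇ p X)
  filterᵇ-stable p p∘s≗p {X} sX =
    ↭-trans (↭-reflexive (sym (filterᵇ-map s p∘s≗p X))) (filterᵇ-↭ p sX)

  memᵛ-stable : ∀ {X} → Stable X → ∀ v → memᵛ (s v) X ≡ memᵛ v X
  memᵛ-stable {X} sX v = bool-ext to from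
    where
      to : memᵛ (s v) X ≡ true → memᵛ v X ≡ true
      to m with ∈-map⁻ s (∈-resp-↭ (↭-sym sX) (memᵛ⇒∈ m))
      ... | x , x∈X , sv≡sx = ∈⇒memᵛ (subst (_∈ X) (sym (s-injective sv≡sx)) x∈X)
      from : memᵛ v X ≡ true → memᵛ (s v) X ≡ true
      from m = ∈⇒memᵛ (∈-resp-↭ sX (∈-map⁺ s (memᵛ⇒∈ m)))

  unique∧memᵛ-invariant⇒stable : ∀ {X} → Unique X → (∀ v → memᵛ (s v) X ≡ memᵛ v X) →
    Stable X
  unique∧memᵛ-invariant⇒stable {X} uX inv =
    ∼bag⇒↭ (unique∧set⇒bag (Unique.map⁺ s-injective uX) uX (mk⇔ to from))
    where
      to : ∀ {y} → y ∈ map s X → y ∈ X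
      to y∈ with ∈-map⁻ s y∈
      ... | x , x∈X , refl = memᵛ⇒∈ (trans (inv x) (∈⇒memᵛ x∈X))
      from : ∀ {y} → y ∈ X → y ∈ map s X
      from {y} y∈X = subst (_∈ map s X) (inverseʳ σ) (∈-map⁺ s (memᵛ⇒∈ s⁻¹y∈X))
        where
          s⁻¹y∈X : memᵛ (σ ⟨$⟩ˡ y) X ≡ true
          s⁻¹y∈X = trans (sym (inv _)) (∈⇒memᵛ (subst (_∈ X) (sym (inverseʳ σ)) y∈X))

  col-stable : ∀ {π} → All Stable π → ∀ v → col π (s v) ≡ col π v
  col-stable [] v = refl
  col-stable {X ∷ π} (sX ∷ sπ) v rewrite memᵛ-stable sX v with memᵛ v X
  ... | true  = refl
  ... | false = cong suc (col-stable sπ v)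

  col-invariant⇒stable : ∀ π → Unique (concat π) → (∀ v → col π (s v) ≡ col π v) →
    All Stable π
  col-invariant⇒stable [] _ _ = []
  col-invariant⇒stable (X ∷ π) u inv with unique-++⁻ X u
  ... | uX , uπ , X#π = unique∧memᵛ-invariant⇒stable uX memᵛ-invariant
                      ∷ col-invariant⇒stable π uπ col-invariant
    where
      memᵛ-invariant : ∀ v → memᵛ (s v) X ≡ memᵛ v X
      memᵛ-invariant v with memᵛ (s v) X | memᵛ v X | inv v
      ... | true  | true  | _  = refl
      ... | false | false | _  = refl
      ... | true  | false | ()
      ... | false | true  | ()
      -- A vertex of X lies in no later cell, so col π gives v and s v the junk colour length π.
      col-invariant : ∀ v → col π (s v) ≡ col π v
      col-invariant v with memᵛ v X in m | memᵛ-invariant v | inv v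
      ... | true  | msv | _ = trans (col-∉ π (λ sv∈ → X#π (memᵛ⇒∈ msv , sv∈)))
                                   (sym (col-∉ π (λ v∈ → X#π (memᵛ⇒∈ m , v∈))))
      ... | false | msv | eq rewrite msv = suc-injective eq

  fixed⇒IndClosed : ∀ {v} → s v ≡ v → IndClosed Stable v
  fixed⇒IndClosed {v} sv≡v =
    ↭-reflexive (cong (_∷ []) sv≡v) ,
    filterᵇ-stable (λ u → not (u =ᵛ v)) (λ x → cong not (=ᵛ-fixed x))
    where
      =ᵛ-fixed : ∀ x → (s x =ᵛ v) ≡ (x =ᵛ v)
      =ᵛ-fixed x with s x Fin.≟ v | x Fin.≟ v
      ... | yes _   | yes _    = refl
      ... | no _    | no _     = refl
      ... | yes sx≡v | no x≢v  = ⊥-elim (x≢v (s-injective (trans sx≡v (sym sv≡v))))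
      ... | no sx≢v | yes refl = ⊥-elim (sx≢v sv≡v)

module _ {n : ℕ} (a : Adj n) (σ : Permutation′ n)
  (σ-adj : ∀ u v → a (σ ⟨$⟩ʳ u) (σ ⟨$⟩ʳ v) ≡ a u v) where

  deg-stable : ∀ {W} → Stable σ W → ∀ v → deg a W (σ ⟨$⟩ʳ v) ≡ deg a W v
  deg-stable {W} sW v = begin
    length (filterᵇ (a (σ ⟨$⟩ʳ v)) W)                   ≡⟨ ↭-length (filterᵇ-↭ _ (↭-sym sW)) ⟩
    length (filterᵇ (a (σ ⟨$⟩ʳ v)) (map (σ ⟨$⟩ʳ_) W))   ≡⟨ cong length (filterᵇ-map _ (σ-adj v) W) ⟩
    length (map (σ ⟨$⟩ʳ_) (filterᵇ (a v) W))            ≡⟨ length-map _ (filterᵇ (a v) W) ⟩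
    length (filterᵇ (a v) W)                            ∎
    where open ≡-Reasoning

  fragments-stable : ∀ {W X} → Stable σ W → Stable σ X → All (Stable σ) (fragments a W X)
  fragments-stable {W} {X} sW sX =
    dropEmpty-All (All.map⁺ (All.universal fragment-stable (upTo (suc (length W)))))
    where
      fragment-stable : ∀ k → Stable σ (filterᵇ (λ v → deg a W v ≡ᵇ k) X)
      fragment-stable k = filterᵇ-stable σ _ (λ x → cong (_≡ᵇ k) (deg-stable sW x)) sX

map-fixed⇒All-fixed : ∀ {A : Set} (f : A → A) xs → map f xs ≡ xs → All (λ x → f x ≡ x) xs
map-fixed⇒All-fixed f [] _ = []
map-fixed⇒All-fixed f (x ∷ xs) eq with ∷-injective eq
... | fx≡x , fxs≡xs = fx≡x ∷ map-fixed⇒All-fixed f xs fxs≡xs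

coloring-unique : ∀ {n} {π : Coloring n} → IsColoring π → Unique (concat π)
coloring-unique {n} (_ , π-partition) =
  ↭ₛ.Unique-resp-↭ (setoid (Fin n)) (↭⇒↭ₛ (↭-sym π-partition)) (Unique.allFin⁺ n)

Rbar-equivariant : ∀ {n} (G : Graph n) (π₀ : Coloring n) → IsColoring π₀ →
  (σ : Permutation′ n) → IsAut (Graph.adj G) π₀ σ →
  ∀ {ν} → map (σ ⟨$⟩ʳ_) ν ≡ ν → IsAut (Graph.adj G) (Rbar G π₀ ν) σ
Rbar-equivariant G π₀ π₀-coloring σ (σ-adj , σ-col) {ν} σν≡ν =
  σ-adj , col-stable σ (Rbar-All ν-ind π₀-stable)
  where
    open Refinement G (Stable σ) (fragments-stable (Graph.adj G) σ σ-adj) using (Rbar-All)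
    ν-ind : All (IndClosed (Stable σ)) ν
    ν-ind = All.map (fixed⇒IndClosed σ) (map-fixed⇒All-fixed _ ν σν≡ν)
    π₀-stable : All (Stable σ) π₀
    π₀-stable = col-invariant⇒stable σ π₀ (coloring-unique π₀-coloring) σ-col

module _ {n : ℕ} (a : Adj n) (π : Coloring n) where

  SameOrbit : Fin n → Fin n → Set
  SameOrbit u₁ u₂ = ∃ λ (σ : Permutation′ n) → IsAut a π σ × σ ⟨$⟩ʳ u₁ ≡ u₂

  SameOrbit-refl : ∀ u → SameOrbit u u
  SameOrbit-refl u = id , ((λ _ _ → refl) , (λ _ → refl)) , refl

  SameOrbit-sym : ∀ {u₁ u₂} → SameOrbit u₁ u₂ → SameOrbit u₂ u₁
  SameOrbit-sym (σ , (σ-adj , σ-col) , refl) =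
    flip σ , (σ⁻¹-adj , σ⁻¹-col) , inverseˡ σ
    where
      σ⁻¹-adj : ∀ u v → a (σ ⟨$⟩ˡ u) (σ ⟨$⟩ˡ v) ≡ a u v
      σ⁻¹-adj u v = trans (sym (σ-adj _ _)) (cong₂ a (inverseʳ σ) (inverseʳ σ))
      σ⁻¹-col : ∀ v → col π (σ ⟨$⟩ˡ v) ≡ col π v
      σ⁻¹-col v = trans (sym (σ-col _)) (cong (col π) (inverseʳ σ))

  SameOrbit-trans : ∀ {u₁ u₂ u₃} → SameOrbit u₁ u₂ → SameOrbit u₂ u₃ → SameOrbit u₁ u₃
  SameOrbit-trans (σ , (σ-adj , σ-col) , refl) (τ , (τ-adj , τ-col) , refl) =
    σ ∘ₚ τ , ((λ u v → trans (τ-adj _ _) (σ-adj u v)) , (λ v → trans (τ-col _) (σ-col v))) , refl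

  InOneOrbit : List (Fin n) → Set
  InOneOrbit Ω = ∀ u₁ u₂ → u₁ ∈ Ω → u₂ ∈ Ω → SameOrbit u₁ u₂

  InOneOrbit-singleton : ∀ v → InOneOrbit (v ∷ [])
  InOneOrbit-singleton v _ _ (here refl) (here refl) = SameOrbit-refl v

  InOneOrbit-++ : ∀ {Ω₁ Ω₂ w₁ w₂} → InOneOrbit Ω₁ → InOneOrbit Ω₂ →
    w₁ ∈ Ω₁ → w₂ ∈ Ω₂ → SameOrbit w₁ w₂ → InOneOrbit (Ω₁ ++ Ω₂)
  InOneOrbit-++ {Ω₁} {Ω₂} {w₁} {w₂} orb₁ orb₂ w₁∈ w₂∈ w₁~w₂ u₁ u₂ u₁∈ u₂∈ =
    SameOrbit-trans (to-w₁ u₁∈) (SameOrbit-sym (to-w₁ u₂∈))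
    where
      to-w₁ : ∀ {u} → u ∈ Ω₁ ++ Ω₂ → SameOrbit u w₁
      to-w₁ {u} u∈ with ∈-++⁻ Ω₁ u∈
      ... | inj₁ u∈₁ = orb₁ u w₁ u∈₁ w₁∈
      ... | inj₂ u∈₂ = SameOrbit-trans (orb₂ u w₂ u∈₂ w₂∈) (SameOrbit-sym w₁~w₂)

open ProofSystem using (orbitsAxiom; mergeOrbits)

lemma4p9 : ∀ {n} (G : Graph n) (π₀ : Coloring n) → IsColoring π₀ → (S : Setting n) →
    ∀ (Ω ν : List (Fin n)) → ProofSystem.⊢_ G π₀ S (orbits Ω ν) →
    ∀ u₁ u₂ → u₁ ∈ Ω → u₂ ∈ Ω →
    ∃ λ (σ : Permutation′ n) → IsAut (Graph.adj G) (Rbar G π₀ ν) σ × σ ⟨$⟩ʳ u₁ ≡ u₂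
lemma4p9 G π₀ π₀-coloring S _ ν (orbitsAxiom v ν) =
  InOneOrbit-singleton (Graph.adj G) (Rbar G π₀ ν) v
lemma4p9 G π₀ π₀-coloring S _ ν
  (mergeOrbits {Ω₁ = Ω₁} {Ω₂} σ w₁ w₂ σ-aut σν≡ν w₁∈ w₂∈ σw₁≡w₂ ⊢Ω₁ ⊢Ω₂) =
  InOneOrbit-++ (Graph.adj G) (Rbar G π₀ ν)
    (lemma4p9 G π₀ π₀-coloring S Ω₁ ν ⊢Ω₁) (lemma4p9 G π₀ π₀-coloring S Ω₂ ν ⊢Ω₂) w₁∈ w₂∈
    (σ , Rbar-equivariant G π₀ π₀-coloring σ σ-aut σν≡ν , σw₁≡w₂)
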